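{- Consider the signature $\{0,\mathrm{app},+,\cdot\}$ with constant $0$, unary function symbol $\mathrm{app}$ (unary append, written postfix as $x1$ in the paper) and binary $+,\cdot$. Let $N_1$ be the term rewriting system given by the left-to-right oriented equations [U1] $x+0=x$; [U2] $x+\mathrm{app}(y)=\mathrm{app}(x)+y$; [U3] $x\cdot 0=0$; [U4] $x\cdot\mathrm{app}(y)=x+(x\cdot y)$. Let the normal forms be the terms $0,\mathrm{app}(0),\mathrm{app}(\mathrm{app}(0)),\dots$. Then $N_1$ is deterministic with respect to addition and multiplication of normal forms: for all such normal forms $t,t'$, in each state of rewriting of $t+t'$ and of $t\cdot t'$ to their normal form, only one rewrite rule of $N_1$ applies (at only one position).
   Context: "Each state of rewriting" means each term reachable by rewrite steps of $N_1$ from the starting term that is not yet a normal form. -}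

module Defs where

open import Data.Nat using (ℕ; zero; suc)
open import Data.List using (List; []; _∷_)
open import Data.Product using (Σ; ∃; _×_; _,_)
open import Relation.Binary.PropositionalEquality using (_≡_)
open import Relation.Binary.Construct.Closure.ReflexiveTransitive using (Star)

-- Ground terms over the signature {0, app, +, ·}.
-- (All terms reachable from t + t' with t, t' normal forms are ground.)
infixl 6 _⊕_
infixl 7 _⊗_
data Term : Set where
  𝟘   : Term
  app : Term → Term
  _⊕_ : Term → Term → Term
  _⊗_ : Term → Term → Term

num : ℕ → Term
num zero    = 𝟘
num (suc n) = app (num n)

IsNF : Term → Set
IsNF t = ∃ λ n → t ≡ num n

data Rule : Set where
  U1 U2 U3 U4 : Rule

data Matches : Rule → Term → Set where
  m1 : ∀ x   → Matches U1 (x ⊕ 𝟘)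
  m2 : ∀ x y → Matches U2 (x ⊕ app y)
  m3 : ∀ x   → Matches U3 (x ⊗ 𝟘)
  m4 : ∀ x y → Matches U4 (x ⊗ app y)

data RootStep : Rule → Term → Term → Set where
  u1 : ∀ x   → RootStep U1 (x ⊕ 𝟘) x
  u2 : ∀ x y → RootStep U2 (x ⊕ app y) (app x ⊕ y)
  u3 : ∀ x   → RootStep U3 (x ⊗ 𝟘) 𝟘
  u4 : ∀ x y → RootStep U4 (x ⊗ app y) (x ⊕ (x ⊗ y))

-- Positions: paths of argument indices (0 = first argument, 1 = second).
Pos : Set
Pos = List ℕ

data RedexAt (r : Rule) : Pos → Term → Set where
  here  : ∀ {t} → Matches r t → RedexAt r [] t
  inApp : ∀ {p t} → RedexAt r p t → RedexAt r (0 ∷ p) (app t)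
  inAddL : ∀ {p a b} → RedexAt r p a → RedexAt r (0 ∷ p) (a ⊕ b)
  inAddR : ∀ {p a b} → RedexAt r p b → RedexAt r (1 ∷ p) (a ⊕ b)
  inMulL : ∀ {p a b} → RedexAt r p a → RedexAt r (0 ∷ p) (a ⊗ b)
  inMulR : ∀ {p a b} → RedexAt r p b → RedexAt r (1 ∷ p) (a ⊗ b)

infix 4 _⟶_
data _⟶_ : Term → Term → Set where
  root  : ∀ {r t t'} → RootStep r t t' → t ⟶ t'
  cApp  : ∀ {t t'} → t ⟶ t' → app t ⟶ app t'
  cAddL : ∀ {a a' b} → a ⟶ a' → a ⊕ b ⟶ a' ⊕ b
  cAddR : ∀ {a b b'} → b ⟶ b' → a ⊕ b ⟶ a ⊕ b'
  cMulL : ∀ {a a' b} → a ⟶ a' → a ⊗ b ⟶ a' ⊗ b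
  cMulR : ∀ {a b b'} → b ⟶ b' → a ⊗ b ⟶ a ⊗ b'

infix 4 _⟶*_
_⟶*_ : Term → Term → Set
_⟶*_ = Star _⟶_

UniqueRedex : Term → Set
UniqueRedex t =
  Σ Rule λ r → Σ Pos λ p → RedexAt r p t ×
    (∀ r' p' → RedexAt r' p' t → (r' ≡ r) × (p' ≡ p))

-- Every term reachable from m + n or m · n is a right-nested sum a₁ + (a₂ + (⋯ + u)) of
-- numerals whose innermost summand u is a numeral or a product of two numerals, and
-- rewriting preserves this shape. In such a term the numerals are irreducible and every
-- inner sum has a non-numeral right argument, so the only redex sits at the innermost
-- non-numeral sum or product, where the outermost symbol of its right argument (0 or app)
-- selects exactly one rule.
module Submission where

open import Defs
open import Data.Nat using (ℕ; zero; suc)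
open import Data.Sum using (_⊎_; inj₁; inj₂)
open import Data.Product using (Σ; _,_)
open import Data.List using (_∷_; [])
open import Data.Empty using (⊥-elim)
open import Relation.Nullary using (¬_)
open import Function using (_∘_)
open import Relation.Binary.PropositionalEquality using (_≡_; refl; cong)
open import Relation.Binary.Construct.Closure.ReflexiveTransitive using (ε; _◅_)

data Numeral : Term → Set where
  zero : Numeral 𝟘
  suc  : ∀ {t} → Numeral t → Numeral (app t)

numeral-num : ∀ n → Numeral (num n)
numeral-num zero    = zero
numeral-num (suc n) = suc (numeral-num n)

Numeral⇒IsNF : ∀ {t} → Numeral t → IsNF t
Numeral⇒IsNF zero = zero , refl
Numeral⇒IsNF (suc x) with Numeral⇒IsNF x
... | n , refl = suc n , refl

Numeral-irreducible : ∀ {t t'} → Numeral t → ¬ (t ⟶ t')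
Numeral-irreducible zero    (root ())
Numeral-irreducible (suc x) (root ())
Numeral-irreducible (suc x) (cApp s) = Numeral-irreducible x s

Numeral-redexFree : ∀ {r p t} → Numeral t → ¬ RedexAt r p t
Numeral-redexFree zero    (here ())
Numeral-redexFree (suc x) (here ())
Numeral-redexFree (suc x) (inApp R) = Numeral-redexFree x R

Matches-functional : ∀ {r r' t} → Matches r t → Matches r' t → r' ≡ r
Matches-functional (m1 _)   (m1 _)   = refl
Matches-functional (m2 _ _) (m2 _ _) = refl
Matches-functional (m3 _)   (m3 _)   = refl
Matches-functional (m4 _ _) (m4 _ _) = refl

data Shape : Term → Set where
  numeral : ∀ {t}   → Numeral t → Shape t
  product : ∀ {a b} → Numeral a → Numeral b → Shape (a ⊗ b)
  sum     : ∀ {a t} → Numeral a → Shape t → Shape (a ⊕ t)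

Shape-step : ∀ {t t'} → Shape t → t ⟶ t' → Shape t'
Shape-step (numeral x)                   s               = ⊥-elim (Numeral-irreducible x s)
Shape-step (product a b)                 (root (u3 _))   = numeral zero
Shape-step (product a (suc b))           (root (u4 _ _)) = sum a (product a b)
Shape-step (product a b)                 (cMulL s)       = ⊥-elim (Numeral-irreducible a s)
Shape-step (product a b)                 (cMulR s)       = ⊥-elim (Numeral-irreducible b s)
Shape-step (sum a t)                     (root (u1 _))   = numeral a
Shape-step (sum a (numeral (suc b)))     (root (u2 _ _)) = sum (suc a) (numeral b)
Shape-step (sum a t)                     (cAddL s)       = ⊥-elim (Numeral-irreducible a s)
Shape-step (sum a t)                     (cAddR s)       = sum a (Shape-step t s)

Shape-star : ∀ {t t'} → Shape t → t ⟶* t' → Shape t'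
Shape-star t ε        = t
Shape-star t (s ◅ ss) = Shape-star (Shape-step t s) ss

matches-⊕-numeral : ∀ {a b} → Numeral b → Σ Rule λ r → Matches r (a ⊕ b)
matches-⊕-numeral zero    = U1 , m1 _
matches-⊕-numeral (suc _) = U2 , m2 _ _

matches-⊗-numeral : ∀ {a b} → Numeral b → Σ Rule λ r → Matches r (a ⊗ b)
matches-⊗-numeral zero    = U3 , m3 _
matches-⊗-numeral (suc _) = U4 , m4 _ _

uniqueRedex-⊕-numerals : ∀ {a b} → Numeral a → Numeral b → UniqueRedex (a ⊕ b)
uniqueRedex-⊕-numerals a b with matches-⊕-numeral b
... | r , m = r , [] , here m , λ where
  r' p' (here m')  → Matches-functional m m' , refl
  r' p' (inAddL R) → ⊥-elim (Numeral-redexFree a R)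
  r' p' (inAddR R) → ⊥-elim (Numeral-redexFree b R)

uniqueRedex-⊗-numerals : ∀ {a b} → Numeral a → Numeral b → UniqueRedex (a ⊗ b)
uniqueRedex-⊗-numerals a b with matches-⊗-numeral b
... | r , m = r , [] , here m , λ where
  r' p' (here m')  → Matches-functional m m' , refl
  r' p' (inMulL R) → ⊥-elim (Numeral-redexFree a R)
  r' p' (inMulR R) → ⊥-elim (Numeral-redexFree b R)

uniqueRedex-⊕-right : ∀ {a t} → Numeral a → (∀ {r} → ¬ Matches r (a ⊕ t)) →
  UniqueRedex t → UniqueRedex (a ⊕ t)
uniqueRedex-⊕-right a no-root (r , p , R , unique) = r , 1 ∷ p , inAddR R , λ where
  r' p' (here m)            → ⊥-elim (no-root m)
  r' p' (inAddL R')         → ⊥-elim (Numeral-redexFree a R')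
  r' _  (inAddR {p = q} R') → let r'≡r , q≡p = unique r' q R' in r'≡r , cong (1 ∷_) q≡p

Shape-uniqueRedex : ∀ {t} → Shape t → ¬ Numeral t → UniqueRedex t
Shape-uniqueRedex (numeral x)             ¬x = ⊥-elim (¬x x)
Shape-uniqueRedex (product a b)           _  = uniqueRedex-⊗-numerals a b
Shape-uniqueRedex (sum a (numeral b))     _  = uniqueRedex-⊕-numerals a b
Shape-uniqueRedex (sum a t@(product _ _)) _  = uniqueRedex-⊕-right a (λ ()) (Shape-uniqueRedex t λ ())
Shape-uniqueRedex (sum a t@(sum _ _))     _  = uniqueRedex-⊕-right a (λ ()) (Shape-uniqueRedex t λ ())

proposition3p1p3 : ∀ (m n : ℕ) (s : Term) →
    ((num m ⊕ num n ⟶* s) ⊎ (num m ⊗ num n ⟶* s)) →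
    ¬ IsNF s → UniqueRedex s
proposition3p1p3 m n s reduction ¬nf =
  Shape-uniqueRedex (reachable-Shape reduction) (¬nf ∘ Numeral⇒IsNF)
  where
    reachable-Shape : (num m ⊕ num n ⟶* s) ⊎ (num m ⊗ num n ⟶* s) → Shape s
    reachable-Shape (inj₁ steps) = Shape-star (sum (numeral-num m) (numeral (numeral-num n))) steps
    reachable-Shape (inj₂ steps) = Shape-star (product (numeral-num m) (numeral-num n)) steps
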